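{- Let $S$ be a c-monoid, let $d(S)=\{x\in S\mid d(x)=x\}$ and $\mathscr{T}(S)=\{x\in S\mid x\cdot 1_\pi=x\}$. Then the map $x\mapsto x\cdot 1_\pi$ sends $d(S)$ into $\mathscr{T}(S)$, the map $d$ sends $\mathscr{T}(S)$ into $d(S)$, and these two maps are mutually inverse bijections: $d(x\cdot 1_\pi)=x$ for all $x\in d(S)$ and $d(z)\cdot 1_\pi=z$ for all $z\in\mathscr{T}(S)$. In particular $d(S)\cong\mathscr{T}(S)$.
   Context: A proto-monoid is a structure $(S,\cdot,1_\sigma)$ with $1_\sigma\cdot x=x=x\cdot 1_\sigma$ for all $x$ (no associativity required). A proto-bi-monoid is $(S,\cdot,\|,1_\sigma,1_\pi)$ such that $(S,\cdot,1_\sigma)$ is a proto-monoid and $(S,\|,1_\pi)$ is a commutative monoid. A c-monoid is a proto-bi-monoid satisfying, for all $x,y$: (c1) $(x\cdot 1_\pi)\|x=x$; (c2) $((x\cdot 1_\pi)\|1_\sigma)\cdot y=(x\cdot 1_\pi)\|y$; (c3) $(x\|y)\cdot 1_\pi=(x\cdot 1_\pi)\|(y\cdot 1_\pi)$; (c4) $(x\cdot y)\cdot 1_\pi=x\cdot(y\cdot 1_\pi)$; (c5) $1_\sigma\|1_\sigma=1_\sigma$. The domain operation is defined by $d(x)=(x\cdot 1_\pi)\|1_\sigma$. -}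

module Defs where

open import Level using (Level; suc)
open import Relation.Binary.PropositionalEquality using (_≡_)
open import Data.Product using (Σ)

record CMonoid (a : Level) : Set (suc a) where
  infixl 7 _·_
  infixl 6 _∥_
  field
    S   : Set a
    _·_ : S → S → S
    _∥_ : S → S → S
    1σ  : S
    1π  : S
    ·-identityˡ : ∀ x → 1σ · x ≡ x
    ·-identityʳ : ∀ x → x · 1σ ≡ x
    ∥-assoc     : ∀ x y z → (x ∥ y) ∥ z ≡ x ∥ (y ∥ z)
    ∥-comm      : ∀ x y → x ∥ y ≡ y ∥ x
    ∥-identityˡ : ∀ x → 1π ∥ x ≡ x
    ∥-identityʳ : ∀ x → x ∥ 1π ≡ x
    c1 : ∀ x → (x · 1π) ∥ x ≡ x
    c2 : ∀ x y → ((x · 1π) ∥ 1σ) · y ≡ (x · 1π) ∥ y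
    c3 : ∀ x y → (x ∥ y) · 1π ≡ (x · 1π) ∥ (y · 1π)
    c4 : ∀ x y → (x · y) · 1π ≡ x · (y · 1π)
    c5 : 1σ ∥ 1σ ≡ 1σ

  d : S → S
  d x = (x · 1π) ∥ 1σ

  dS : Set a
  dS = Σ S (λ x → d x ≡ x)

  TS : Set a
  TS = Σ S (λ x → x · 1π ≡ x)

-- Post-composition with 1π is idempotent (by c1 and c4) and is left unchanged by d (by c3),
-- so d and (_· 1π) restrict to mutually inverse maps between the fixed points of d and
-- those of (_· 1π).
module Submission where

open import Defs
open import Level using (Level)
open import Relation.Binary.PropositionalEquality using (_≡_; sym; trans; cong; cong₂; module ≡-Reasoning)
open import Data.Product using (_×_; _,_)
open import Data.Product.Properties using (Σ-≡,≡→≡)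
open import Function.Bundles using (_↔_; mk↔ₛ′)
open import Axiom.UniquenessOfIdentityProofs.WithK using (uip)

module _ {a : Level} (M : CMonoid a) where
  open CMonoid M
  open ≡-Reasoning

  1π·1π≡1π : 1π · 1π ≡ 1π
  1π·1π≡1π = begin
    1π · 1π         ≡⟨ sym (∥-identityʳ _) ⟩
    (1π · 1π) ∥ 1π  ≡⟨ c1 1π ⟩
    1π              ∎

  ·1π-idem : ∀ x → (x · 1π) · 1π ≡ x · 1π
  ·1π-idem x = trans (c4 x 1π) (cong (x ·_) 1π·1π≡1π)

  d-·1π : ∀ x → d x · 1π ≡ x · 1π
  d-·1π x = begin
    ((x · 1π) ∥ 1σ) · 1π         ≡⟨ c3 _ _ ⟩
    ((x · 1π) · 1π) ∥ (1σ · 1π)  ≡⟨ cong₂ _∥_ (·1π-idem x) (·-identityˡ 1π) ⟩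
    (x · 1π) ∥ 1π                ≡⟨ ∥-identityʳ _ ⟩
    x · 1π                       ∎

  d-idem : ∀ x → d (d x) ≡ d x
  d-idem x = cong (_∥ 1σ) (d-·1π x)

  d∘·1π : ∀ x → d (x · 1π) ≡ d x
  d∘·1π x = cong (_∥ 1σ) (·1π-idem x)

  d∘·1π-fix : ∀ x → d x ≡ x → d (x · 1π) ≡ x
  d∘·1π-fix x dx≡x = trans (d∘·1π x) dx≡x

  ·1π∘d-fix : ∀ z → z · 1π ≡ z → d z · 1π ≡ z
  ·1π∘d-fix z z·1π≡z = trans (d-·1π z) z·1π≡z

  dS↔TS : dS ↔ TS
  dS↔TS = mk↔ₛ′ to from to∘from from∘to
    where
    to : dS → TS
    to (x , _) = x · 1π , ·1π-idem x

    from : TS → dS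
    from (z , _) = d z , d-idem z

    to∘from : ∀ t → to (from t) ≡ t
    to∘from (z , z·1π≡z) = Σ-≡,≡→≡ (·1π∘d-fix z z·1π≡z , uip _ _)

    from∘to : ∀ s → from (to s) ≡ s
    from∘to (x , dx≡x) = Σ-≡,≡→≡ (d∘·1π-fix x dx≡x , uip _ _)

proposition8 : ∀ {a : Level} (M : CMonoid a) → let open CMonoid M in
    ((∀ x → d x ≡ x → (x · 1π) · 1π ≡ x · 1π) × (∀ z → z · 1π ≡ z → d (d z) ≡ d z))
    × ((∀ x → d x ≡ x → d (x · 1π) ≡ x) × (∀ z → z · 1π ≡ z → d z · 1π ≡ z))
    × (dS ↔ TS)
proposition8 M =
  ((λ x _ → ·1π-idem M x) , (λ z _ → d-idem M z)) ,
  (d∘·1π-fix M , ·1π∘d-fix M) ,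
  dS↔TS M
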